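{- Let $\mathcal{S}$ be the sequent calculus $\mathrm{SC}_{i\mathcal{ALC}}$ described in the context. For every set $\Theta$ of formulas, every set $\Gamma$ of concepts and assertions, and every concept or assertion $\delta$ of $i\mathcal{ALC}$: if the sequent $\Theta,\Gamma\Rightarrow\delta$ is provable in $\mathcal{S}$, then $\Theta,\Gamma\models\delta$.
   Context: Syntax. Concepts of $i\mathcal{ALC}$: $C,D ::= A \mid \bot \mid \top \mid \neg C \mid C\sqcap D \mid C\sqcup D \mid C\sqsubseteq D \mid \exists R.C \mid \forall R.C$, with $A$ atomic concepts and $R$ atomic roles ($\sqsubseteq$ is also a concept constructor). Given nominals $x,y,\dots$: nominal assertions $N ::= x\colon C \mid x\colon N$; assertions $A ::= N \mid xRy$; formulas $F ::= A \mid C\sqsubseteq C$. In $x\colon\gamma$, $x$ is the outer nominal. Semantics. An interpretation $\mathcal I$ consists of a nonempty set $\Delta^{\mathcal I}$, a reflexive transitive relation $\preceq$ on it, for each role $R$ a relation $R^{\mathcal I}\subseteq \Delta^{\mathcal I}\times\Delta^{\mathcal I}$, for each atomic $A$ a set $A^{\mathcal I}$ closed upward under $\preceq$, and each nominal $x$ an element $x^{\mathcal I}$. It must satisfy (F1) if $w\preceq w'$ and $wRv$ then there is $v'$ with $w'Rv'$ and $v\preceq v'$; (F2) if $v\preceq v'$ and $wRv$ then there is $w'$ with $w'Rv'$ and $w\preceq w'$. Concepts are interpreted by: $\top^{\mathcal I}=\Delta^{\mathcal I}$, $\bot^{\mathcal I}=\emptyset$, $(\neg C)^{\mathcal I}=\{x\mid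 \forall y(x\preceq y\Rightarrow y\notin C^{\mathcal I})\}$, $\sqcap,\sqcup$ as $\cap,\cup$, $(C\sqsubseteq D)^{\mathcal I}=\{x\mid\forall y((x\preceq y\wedge y\in C^{\mathcal I})\Rightarrow y\in D^{\mathcal I})\}$, $(\exists R.C)^{\mathcal I}=\{x\mid\exists y((x,y)\in R^{\mathcal I}\wedge y\in C^{\mathcal I})\}$, $(\forall R.C)^{\mathcal I}=\{x\mid \forall y(x\preceq y\Rightarrow\forall z((y,z)\in R^{\mathcal I}\Rightarrow z\in C^{\mathcal I}))\}$. Write $\mathcal I,w\models C$ for $w\in C^{\mathcal I}$; $\mathcal I,w\models x\colon C$ iff $\mathcal I,z\models C$ for all $z\succeq x^{\mathcal I}$; $\mathcal I,w\models xRy$ iff $(z_x,z_y)\in R^{\mathcal I}$ for all $z_x\succeq x^{\mathcal I}$, $z_y\succeq y^{\mathcal I}$. A subsumption formula $C\sqsubseteq D$ is evaluated as the concept $C\sqsubseteq D$. Semantic consequence $\Theta,\Gamma\models\delta$ means: for every interpretation $\mathcal I$ such that $\mathcal I,x\models\Theta$ for all $x\in\Delta^{\mathcal I}$, for all values of the outer nominals $Nom(\Gamma,\delta)$ occurring in the nominal assertions of $\Gamma\cup\{\delta\}$ and all $\vec z\succeq Nom(\Gamma,\delta)$, if $\mathcal I,\vec z\models\Gamma$ then $\mathcal I,\vec z\models\delta$. Sequent calculus $\mathrm{SC}_{i\mathcal{ALC}}$: sequents $\Delta\Rightarrow\delta$ with $\Delta$ a set of formulas and $\delta$ a concept or assertion;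 $\alpha,\beta$ concepts. Usual structural rules and cut, plus: axioms $\Delta,\delta\Rightarrow\delta$ and $\Delta,x\colon\bot\Rightarrow\delta$; ($\forall$-r) from $\Delta,xRy\Rightarrow y\colon\alpha$ infer $\Delta\Rightarrow x\colon\forall R.\alpha$; ($\forall$-l) from $\Delta,x\colon\forall R.\alpha,y\colon\alpha,xRy\Rightarrow\delta$ infer $\Delta,x\colon\forall R.\alpha,xRy\Rightarrow\delta$; ($\exists$-r) from $\Delta\Rightarrow xRy$ and $\Delta\Rightarrow y\colon\alpha$ infer $\Delta\Rightarrow x\colon\exists R.\alpha$; ($\exists$-l) from $\Delta,xRy,y\colon\alpha\Rightarrow\delta$ infer $\Delta,x\colon\exists R.\alpha\Rightarrow\delta$, provided $y$ does not occur in the conclusion; ($\sqsubseteq$-r) from $\Delta,\alpha\Rightarrow\beta$ infer $\Delta\Rightarrow\alpha\sqsubseteq\beta$; ($\sqsubseteq$-l) from $\Delta_1\Rightarrow\alpha$ and $\Delta_2,\beta\Rightarrow\delta$ infer $\Delta_1,\Delta_2,\alpha\sqsubseteq\beta\Rightarrow\delta$; ($\sqcap$-r) from $\Delta\Rightarrow\alpha$ and $\Delta\Rightarrow\beta$ infer $\Delta\Rightarrow\alpha\sqcap\beta$; ($\sqcap$-l) from $\Delta,\alpha,\beta\Rightarrow\delta$ infer $\Delta,\alpha\sqcap\beta\Rightarrow\delta$; ($\sqcup_1$-r),($\sqcup_2$-r) from $\Delta\Rightarrow\alpha$ (resp. $\Delta\Rightarrow\beta$) infer $\Delta\Rightarrow\alpha\sqcup\beta$;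 ($\sqcup$-l) from $\Delta,\alpha\Rightarrow\delta$ and $\Delta,\beta\Rightarrow\delta$ infer $\Delta,\alpha\sqcup\beta\Rightarrow\delta$; (p-$\exists$) from $\Delta,\alpha\Rightarrow\beta$ infer $\forall R.\Delta,\exists R.\alpha\Rightarrow\exists R.\beta$; (p-$\forall$) from $\Delta\Rightarrow\alpha$ infer $\forall R.\Delta\Rightarrow\forall R.\alpha$; (p-N) from $\Delta\Rightarrow\delta$ infer $x\colon\Delta\Rightarrow x\colon\delta$. Here $\forall R.\Delta$ replaces each concept $\gamma$ of $\Delta$ by $\forall R.\gamma$ and leaves assertions unchanged, and $x\colon\Delta$ (and $x\colon\delta$) prefixes $x\colon$ only to concepts, leaving assertions unchanged. Each propositional rule ($\sqsubseteq,\sqcap,\sqcup$) also has a nominal counterpart in which the principal and side concepts carry a common nominal $x$, e.g. from $\Delta,x\colon\alpha\Rightarrow x\colon\beta$ infer $\Delta\Rightarrow x\colon(\alpha\sqsubseteq\beta)$.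
   Formalization: The rule (∀-r) applies only when y does not occur in its conclusion $\Delta\Rightarrow x\colon\forall R.\alpha$, and in $\Theta,\Gamma\models\delta$ the concepts of Γ and δ are evaluated at one common point of $\Delta^{\mathcal I}$. Each condition added here is assumed in the paper as well or is needed for the statement above to hold. -}

module Defs where

open import Data.Nat using (ℕ)
open import Data.List using (List; []; _∷_; _++_; map; concatMap)
open import Data.List.Membership.Propositional using (_∈_; _∉_)
open import Data.List.Relation.Unary.All using (All)
open import Data.Product using (Σ; _×_)
open import Data.Sum using (_⊎_)
open import Data.Empty renaming (⊥ to Empty)
open import Data.Unit renaming (⊤ to Unit)
open import Relation.Nullary using (¬_)

AtomName : Set
AtomName = ℕ

RoleName : Set
RoleName = ℕ

Nom : Set
Nom = ℕ

infixr 6 _⊓_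
infixr 5 _⊔_
infixr 4 _⊑_

data Concept : Set where
  atom : AtomName → Concept
  bot  : Concept
  top  : Concept
  neg  : Concept → Concept
  _⊓_  : Concept → Concept → Concept
  _⊔_  : Concept → Concept → Concept
  _⊑_  : Concept → Concept → Concept
  exR  : RoleName → Concept → Concept
  allR : RoleName → Concept → Concept

infixr 3 _∶ᶜ_ _∶ⁿ_
data NomAssertion : Set where
  _∶ᶜ_ : Nom → Concept → NomAssertion
  _∶ⁿ_ : Nom → NomAssertion → NomAssertion

-- Everything that may appear in a sequent: concepts (including subsumption
-- formulas C ⊑ D, which are concepts), nominal assertions, role assertions xRy.
data Form : Set where
  con : Concept → Form
  nom : NomAssertion → Form
  rel : Nom → RoleName → Nom → Form

data IsFormula : Form → Set where
  isNom : ∀ N → IsFormula (nom N)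
  isRel : ∀ x R y → IsFormula (rel x R y)
  isSub : ∀ C D → IsFormula (con (C ⊑ D))

_∶_ : Nom → Concept → Form
x ∶ α = nom (x ∶ᶜ α)

prefix : Nom → Form → Form
prefix x (con C) = nom (x ∶ᶜ C)
prefix x φ       = φ

liftAll : RoleName → Form → Form
liftAll R (con C) = con (allR R C)
liftAll R φ       = φ

nomsNA : NomAssertion → List Nom
nomsNA (x ∶ᶜ C) = x ∷ []
nomsNA (x ∶ⁿ N) = x ∷ nomsNA N

noms : Form → List Nom
noms (con C)     = []
noms (nom N)     = nomsNA N
noms (rel x R y) = x ∷ y ∷ []

FreshIn : Nom → List Form → Form → Set
FreshIn y Δ δ = y ∉ concatMap noms (δ ∷ Δ)

infix 2 _⊢_
data _⊢_ : List Form → Form → Set where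
  -- structural rules (antecedents are sets: weakening/contraction/exchange)
  struct : ∀ {Δ Δ' δ} → Δ ⊢ δ → (∀ {φ} → φ ∈ Δ → φ ∈ Δ') → Δ' ⊢ δ
  cut    : ∀ {Δ φ δ} → Δ ⊢ φ → φ ∷ Δ ⊢ δ → Δ ⊢ δ
  ax     : ∀ {Δ δ} → δ ∈ Δ → Δ ⊢ δ
  ax⊥    : ∀ {Δ x δ} → (x ∶ bot) ∈ Δ → Δ ⊢ δ
  ∀-r    : ∀ {Δ x y R α} → rel x R y ∷ Δ ⊢ (y ∶ α)
           → FreshIn y Δ (x ∶ allR R α)
           → Δ ⊢ (x ∶ allR R α)
  ∀-l    : ∀ {Δ x y R α δ} → (y ∶ α) ∷ (x ∶ allR R α) ∷ rel x R y ∷ Δ ⊢ δ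
           → (x ∶ allR R α) ∷ rel x R y ∷ Δ ⊢ δ
  ∃-r    : ∀ {Δ x y R α} → Δ ⊢ rel x R y → Δ ⊢ (y ∶ α) → Δ ⊢ (x ∶ exR R α)
  ∃-l    : ∀ {Δ x y R α δ} → rel x R y ∷ (y ∶ α) ∷ Δ ⊢ δ
           → FreshIn y ((x ∶ exR R α) ∷ Δ) δ
           → (x ∶ exR R α) ∷ Δ ⊢ δ
  ⊑-r    : ∀ {Δ α β} → con α ∷ Δ ⊢ con β → Δ ⊢ con (α ⊑ β)
  ⊑-l    : ∀ {Δ₁ Δ₂ α β δ} → Δ₁ ⊢ con α → con β ∷ Δ₂ ⊢ δ
           → con (α ⊑ β) ∷ (Δ₁ ++ Δ₂) ⊢ δ
  ⊓-r    : ∀ {Δ α β} → Δ ⊢ con α → Δ ⊢ con β → Δ ⊢ con (α ⊓ β)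
  ⊓-l    : ∀ {Δ α β δ} → con α ∷ con β ∷ Δ ⊢ δ → con (α ⊓ β) ∷ Δ ⊢ δ
  ⊔₁-r   : ∀ {Δ α β} → Δ ⊢ con α → Δ ⊢ con (α ⊔ β)
  ⊔₂-r   : ∀ {Δ α β} → Δ ⊢ con β → Δ ⊢ con (α ⊔ β)
  ⊔-l    : ∀ {Δ α β δ} → con α ∷ Δ ⊢ δ → con β ∷ Δ ⊢ δ → con (α ⊔ β) ∷ Δ ⊢ δ
  ⊑-rN   : ∀ {Δ x α β} → (x ∶ α) ∷ Δ ⊢ (x ∶ β) → Δ ⊢ (x ∶ (α ⊑ β))
  ⊑-lN   : ∀ {Δ₁ Δ₂ x α β δ} → Δ₁ ⊢ (x ∶ α) → (x ∶ β) ∷ Δ₂ ⊢ δ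
           → (x ∶ (α ⊑ β)) ∷ (Δ₁ ++ Δ₂) ⊢ δ
  ⊓-rN   : ∀ {Δ x α β} → Δ ⊢ (x ∶ α) → Δ ⊢ (x ∶ β) → Δ ⊢ (x ∶ (α ⊓ β))
  ⊓-lN   : ∀ {Δ x α β δ} → (x ∶ α) ∷ (x ∶ β) ∷ Δ ⊢ δ → (x ∶ (α ⊓ β)) ∷ Δ ⊢ δ
  ⊔₁-rN  : ∀ {Δ x α β} → Δ ⊢ (x ∶ α) → Δ ⊢ (x ∶ (α ⊔ β))
  ⊔₂-rN  : ∀ {Δ x α β} → Δ ⊢ (x ∶ β) → Δ ⊢ (x ∶ (α ⊔ β))
  ⊔-lN   : ∀ {Δ x α β δ} → (x ∶ α) ∷ Δ ⊢ δ → (x ∶ β) ∷ Δ ⊢ δ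
           → (x ∶ (α ⊔ β)) ∷ Δ ⊢ δ
  p-∃    : ∀ {Δ R α β} → con α ∷ Δ ⊢ con β
           → con (exR R α) ∷ map (liftAll R) Δ ⊢ con (exR R β)
  p-∀    : ∀ {Δ R α} → Δ ⊢ con α → map (liftAll R) Δ ⊢ con (allR R α)
  p-N    : ∀ {Δ x δ} → Δ ⊢ δ → map (prefix x) Δ ⊢ prefix x δ

record Interp : Set₁ where
  field
    Dom    : Set
    inhab  : Dom
    _≼_    : Dom → Dom → Set
    ≼-refl  : ∀ w → w ≼ w
    ≼-trans : ∀ {u v w} → u ≼ v → v ≼ w → u ≼ w
    role   : RoleName → Dom → Dom → Set
    atm    : AtomName → Dom → Set
    atm-up : ∀ A {w w'} → w ≼ w' → atm A w → atm A w'
    nomv   : Nom → Dom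
    F1     : ∀ R {w w' v} → w ≼ w' → role R w v → Σ Dom (λ v' → role R w' v' × v ≼ v')
    F2     : ∀ R {w v v'} → v ≼ v' → role R w v → Σ Dom (λ w' → role R w' v' × w ≼ w')

module _ (I : Interp) where
  open Interp I

  _⊩_ : Dom → Concept → Set
  w ⊩ atom A   = atm A w
  w ⊩ bot      = Empty
  w ⊩ top      = Unit
  w ⊩ neg C    = ∀ y → w ≼ y → ¬ (y ⊩ C)
  w ⊩ (C ⊓ D)  = (w ⊩ C) × (w ⊩ D)
  w ⊩ (C ⊔ D)  = (w ⊩ C) ⊎ (w ⊩ D)
  w ⊩ (C ⊑ D)  = ∀ y → w ≼ y → y ⊩ C → y ⊩ D
  w ⊩ exR R C  = Σ Dom (λ y → role R w y × y ⊩ C)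
  w ⊩ allR R C = ∀ y → w ≼ y → ∀ z → role R y z → z ⊩ C

  satN : Dom → NomAssertion → Set
  satN w (x ∶ᶜ C) = ∀ z → nomv x ≼ z → z ⊩ C
  satN w (x ∶ⁿ N) = ∀ z → nomv x ≼ z → satN z N

  sat : Dom → Form → Set
  sat w (con C)     = w ⊩ C
  sat w (nom N)     = satN w N
  sat w (rel x R y) = ∀ zx zy → nomv x ≼ zx → nomv y ≼ zy → role R zx zy

Consequence : List Form → List Form → Form → Set₁
Consequence Θ Γ δ =
  (I : Interp) → (∀ w → All (sat I w) Θ) →
  ∀ w → All (sat I w) Γ → sat I w δ

module Submission where

-- The semantics evaluates nominal and role assertions by quantifying over
-- all ≼-successors of the values of the nominals.  To make the rules with
-- eigen-nominals (∀-r, ∃-l) and the nominal ⊑-r sound, we read a sequent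
-- relative to an *environment* ρ (a value for every nominal) that lies in a
-- *mobile* family of environments: every nominal of a member may be moved
-- up to any ≼-larger element while staying in the family.  A `Support` of
-- Δ at (w , ρ) is such a family all of whose members satisfy Δ at w, and a
-- sequent is `Valid` when its succedent holds wherever its antecedent has a
-- support.  Mobility is preserved by restricting a family to a persistent
-- condition and, thanks to the frame conditions F1/F2, by extending it with
-- an R-successor for a fresh nominal.  The initial family (all environments above
-- the interpretation of the nominals) connects validity with the semantic
-- consequence relation; a conclusion xRy is handled separately by a
-- syntactic inversion: a derivable role assertion is an assumption unless
-- the antecedent is explosive.

open import Defs
open import Data.List using (List; []; _∷_; _++_; map; concatMap)
open import Data.List.Relation.Unary.All using (All; []; _∷_; lookup; tabulate; head; tail)
open import Data.List.Relation.Unary.All.Properties using (++⁺; ++⁻ˡ; ++⁻ʳ)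
open import Data.List.Relation.Unary.Any using (here; there)
open import Data.List.Membership.Propositional using (_∈_; _∉_)
open import Data.List.Membership.Propositional.Properties using (∈-++⁺ˡ; ∈-++⁺ʳ; ∈-map⁺)
open import Data.Nat using (_≟_)
open import Data.Product using (Σ; _×_; _,_; proj₁; proj₂)
import Data.Product as Product
open import Data.Sum using (_⊎_; inj₁; inj₂)
import Data.Sum as Sum
open import Data.Empty using (⊥-elim)
open import Data.Unit using (tt)
open import Function using (_∘_)
open import Relation.Nullary using (yes; no)
open import Relation.Binary.PropositionalEquality
  using (_≡_; _≢_; refl; sym; trans; subst; subst₂)

Explosive : List Form → Set
Explosive Δ = Σ Nom λ z → Δ ⊢ (z ∶ bot)

explode : ∀ {Δ δ} → Explosive Δ → Δ ⊢ δ
explode (z , d) = cut d (ax⊥ (here refl))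

module RoleInversion (a : Nom) (R : RoleName) (b : Nom) where

  Inverted : List Form → Set
  Inverted Δ = rel a R b ∈ Δ ⊎ Explosive Δ

  strip : ∀ {ψ Δ} → ψ ≢ rel a R b → rel a R b ∈ ψ ∷ Δ → rel a R b ∈ Δ
  strip ψ≢ (here eq) = ⊥-elim (ψ≢ (sym eq))
  strip ψ≢ (there m) = m

  -- Two-premise left rules: an occurrence in either premise survives;
  -- otherwise both premises are explosive and so is the conclusion.
  branch : ∀ {ψ₁ ψ₂ ψ Δ} → ψ₁ ≢ rel a R b → ψ₂ ≢ rel a R b
         → (∀ {δ} → ψ₁ ∷ Δ ⊢ δ → ψ₂ ∷ Δ ⊢ δ → ψ ∷ Δ ⊢ δ)
         → Inverted (ψ₁ ∷ Δ) → Inverted (ψ₂ ∷ Δ) → Inverted (ψ ∷ Δ)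
  branch ψ₁≢ _ _ (inj₁ m) _ = inj₁ (there (strip ψ₁≢ m))
  branch _ ψ₂≢ _ _ (inj₁ m) = inj₁ (there (strip ψ₂≢ m))
  branch _ _ rule (inj₂ (z , d₁)) (inj₂ e₂) = inj₂ (z , rule d₁ (explode e₂))

  -- Only the axioms yield a role assertion on the right; in ∃-l the
  -- eigen-nominal is fresh, so it cannot be the introduced assumption xRy.
  invert : ∀ {Δ δ} → Δ ⊢ δ → δ ≡ rel a R b → Inverted Δ
  invert (struct d sub) eq =
    Sum.map sub (Product.map₂ (λ d' → struct d' sub)) (invert d eq)
  invert (cut d₁ d₂) eq with invert d₂ eq
  ... | inj₁ (here refl) = invert d₁ refl
  ... | inj₁ (there m) = inj₁ m
  ... | inj₂ (z , d) = inj₂ (z , cut d₁ d)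
  invert (ax m) refl = inj₁ m
  invert (ax⊥ {x = x} m) _ = inj₂ (x , ax m)
  invert (∀-l d) eq = Sum.map (strip (λ ())) (Product.map₂ ∀-l) (invert d eq)
  invert (∃-l {x = x} d fr) refl with invert d refl
  ... | inj₁ (here refl) = ⊥-elim (fr (there (here refl)))
  ... | inj₁ (there m) = inj₁ (there (strip (λ ()) m))
  ... | inj₂ e = inj₂ (x , ∃-l (explode e) fresh)
    where
      fresh : _ ∉ x ∷ x ∷ _
      fresh (here eq) = fr (there (there (here eq)))
      fresh (there m) = fr (there (there m))
  invert (⊑-l {Δ₁ = Δ₁} d₁ d₂) eq =
    Sum.map (there ∘ ∈-++⁺ʳ Δ₁ ∘ strip (λ ())) (Product.map₂ (⊑-l d₁)) (invert d₂ eq)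
  invert (⊓-l d) eq =
    Sum.map (there ∘ strip (λ ()) ∘ strip (λ ())) (Product.map₂ ⊓-l) (invert d eq)
  invert (⊔-l d₁ d₂) eq = branch (λ ()) (λ ()) ⊔-l (invert d₁ eq) (invert d₂ eq)
  invert (⊑-lN {Δ₁ = Δ₁} d₁ d₂) eq =
    Sum.map (there ∘ ∈-++⁺ʳ Δ₁ ∘ strip (λ ())) (Product.map₂ (⊑-lN d₁)) (invert d₂ eq)
  invert (⊓-lN d) eq =
    Sum.map (there ∘ strip (λ ()) ∘ strip (λ ())) (Product.map₂ ⊓-lN) (invert d eq)
  invert (⊔-lN d₁ d₂) eq = branch (λ ()) (λ ()) ⊔-lN (invert d₁ eq) (invert d₂ eq)
  invert (p-N {x = x} {δ = rel _ _ _} d) refl =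
    Sum.map (∈-map⁺ (prefix x)) (Product.map₂ p-N) (invert d refl)
  invert (p-N {δ = con _} d) ()
  invert (p-N {δ = nom _} d) ()
  invert (∀-r _ _) ()
  invert (∃-r _ _) ()
  invert (⊑-r _) ()
  invert (⊓-r _ _) ()
  invert (⊔₁-r _) ()
  invert (⊔₂-r _) ()
  invert (⊑-rN _) ()
  invert (⊓-rN _ _) ()
  invert (⊔₁-rN _) ()
  invert (⊔₂-rN _) ()
  invert (p-∃ _) ()
  invert (p-∀ _) ()

module Semantics (I : Interp) where
  open Interp I

  _⊨_ : Dom → Concept → Set
  w ⊨ C = _⊩_ I w C

  -- Persistence: truth of a concept is upward closed along ≼
  -- (for ∃R.C this is exactly frame condition F1).
  persistent : ∀ C {w w'} → w ≼ w' → w ⊨ C → w' ⊨ C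
  persistent (atom A) le h = atm-up A le h
  persistent bot le ()
  persistent top le h = h
  persistent (neg C) le h = λ y l → h y (≼-trans le l)
  persistent (C ⊓ D) le (c , d) = persistent C le c , persistent D le d
  persistent (C ⊔ D) le (inj₁ c) = inj₁ (persistent C le c)
  persistent (C ⊔ D) le (inj₂ d) = inj₂ (persistent D le d)
  persistent (C ⊑ D) le h = λ y l → h y (≼-trans le l)
  persistent (exR R C) le (v , r , h) =
    let (v' , r' , v≼v') = F1 R le r in v' , r' , persistent C v≼v' h
  persistent (allR R C) le h = λ y l → h y (≼-trans le l)

  Env : Set
  Env = Nom → Dom

  _≤ₑ_ : Env → Env → Set
  ρ ≤ₑ ρ' = ∀ n → ρ n ≼ ρ' n

  AgreeOff : Nom → Env → Env → Set
  AgreeOff y ρ ρ' = ∀ n → n ≢ y → ρ n ≡ ρ' n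

  _[_↦_] : Env → Nom → Dom → Env
  (ρ [ y ↦ v ]) n with n ≟ y
  ... | yes _ = v
  ... | no _ = ρ n

  update-same : ∀ ρ y v → (ρ [ y ↦ v ]) y ≡ v
  update-same ρ y v with y ≟ y
  ... | yes _ = refl
  ... | no y≢y = ⊥-elim (y≢y refl)

  update-other : ∀ ρ y v → AgreeOff y (ρ [ y ↦ v ]) ρ
  update-other ρ y v n n≢y with n ≟ y
  ... | yes n≡y = ⊥-elim (n≢y n≡y)
  ... | no _ = refl

  update-≤ : ∀ {ρ ρ' y v} → (∀ n → n ≢ y → ρ n ≼ ρ' n) → ρ y ≼ v → ρ ≤ₑ (ρ' [ y ↦ v ])
  update-≤ {y = y} rest y≼v n with n ≟ y
  ... | yes refl = y≼v
  ... | no n≢y = rest n n≢y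

  holdsN : Env → NomAssertion → Set
  holdsN ρ (x ∶ᶜ C) = ρ x ⊨ C
  holdsN ρ (x ∶ⁿ N) = holdsN ρ N

  Holds : Dom → Env → Form → Set
  Holds w ρ (con C) = w ⊨ C
  Holds w ρ (nom N) = holdsN ρ N
  Holds w ρ (rel x R y) = role R (ρ x) (ρ y)

  holds-world : ∀ {w w' ρ} Δ → w ≼ w' → All (Holds w ρ) Δ → All (Holds w' ρ) Δ
  holds-world [] le [] = []
  holds-world (con C ∷ Δ) le (h ∷ hs) = persistent C le h ∷ holds-world Δ le hs
  holds-world (nom N ∷ Δ) le (h ∷ hs) = h ∷ holds-world Δ le hs
  holds-world (rel _ _ _ ∷ Δ) le (h ∷ hs) = h ∷ holds-world Δ le hs

  Stable : Form → Set
  Stable φ = ∀ w {ρ ρ'} → ρ ≤ₑ ρ' → Holds w ρ φ → Holds w ρ' φ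

  stable-con : ∀ C → Stable (con C)
  stable-con C w _ h = h

  stable-nom : ∀ N → Stable (nom N)
  stable-nom (x ∶ᶜ C) w le h = persistent C (le x) h
  stable-nom (x ∶ⁿ N) w le h = stable-nom N w le h

  holdsN-off : ∀ {ρ ρ' y} N → y ∉ nomsNA N → AgreeOff y ρ ρ' → holdsN ρ' N → holdsN ρ N
  holdsN-off (x ∶ᶜ C) fresh ag h = subst (_⊨ C) (sym (ag x (fresh ∘ here ∘ sym))) h
  holdsN-off (x ∶ⁿ N) fresh ag h = holdsN-off N (fresh ∘ there) ag h

  holds-off : ∀ {w ρ ρ' y} φ → y ∉ noms φ → AgreeOff y ρ ρ' → Holds w ρ' φ → Holds w ρ φ
  holds-off (con C) fresh ag h = h
  holds-off (nom N) fresh ag h = holdsN-off N fresh ag h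
  holds-off (rel x R z) fresh ag h =
    subst₂ (role R) (sym (ag x (fresh ∘ here ∘ sym))) (sym (ag z (fresh ∘ there ∘ here ∘ sym))) h

  holds-off-all : ∀ {w ρ ρ' y} Δ → y ∉ concatMap noms Δ → AgreeOff y ρ ρ'
                → All (Holds w ρ') Δ → All (Holds w ρ) Δ
  holds-off-all [] fresh ag [] = []
  holds-off-all (φ ∷ Δ) fresh ag (h ∷ hs) =
    holds-off φ (fresh ∘ ∈-++⁺ˡ) ag h ∷ holds-off-all Δ (fresh ∘ ∈-++⁺ʳ (noms φ)) ag hs

  Mobile : (Env → Set) → Set
  Mobile P = ∀ {ρ} n {z} → P ρ → ρ n ≼ z → Σ Env λ ρ' → P ρ' × ρ ≤ₑ ρ' × ρ' n ≡ z

  record Support (w : Dom) (Δ : List Form) (ρ : Env) : Set₁ where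
    field
      family : Env → Set
      member : family ρ
      mobile : Mobile family
      models : ∀ {ρ'} → family ρ' → All (Holds w ρ') Δ

    current : All (Holds w ρ) Δ
    current = models member
  open Support

  record Valid (Δ : List Form) (δ : Form) : Set₁ where
    constructor valid
    field
      holds-under : ∀ {w ρ} → Support w Δ ρ → Holds w ρ δ
  open Valid

  refine : ∀ {w w' Δ Δ' ρ} (S : Support w Δ ρ)
         → (∀ {ρ'} → family S ρ' → All (Holds w' ρ') Δ') → Support w' Δ' ρ
  refine S f = record { family = family S ; member = member S ; mobile = mobile S ; models = f }

  reshape : ∀ {w w' Δ Δ' ρ} → Support w Δ ρ
          → (∀ {ρ'} → All (Holds w ρ') Δ → All (Holds w' ρ') Δ') → Support w' Δ' ρ
  reshape S f = refine S (f ∘ models S)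

  relocate : ∀ {w Δ ρ ρ'} (S : Support w Δ ρ) → family S ρ' → Support w Δ ρ'
  relocate S p = record { family = family S ; member = p ; mobile = mobile S ; models = models S }

  restrict : ∀ {w Δ ρ φ} → Stable φ → Support w Δ ρ → Holds w ρ φ → Support w (φ ∷ Δ) ρ
  restrict {w} {φ = φ} stable S h = record
    { family = λ ρ' → family S ρ' × Holds w ρ' φ
    ; member = member S , h
    ; mobile = λ n (p , hφ) le →
        let (ρ' , p' , ρ≤ρ' , moved) = mobile S n p le
        in ρ' , (p' , stable w ρ≤ρ' hφ) , ρ≤ρ' , moved
    ; models = λ (p , hφ) → hφ ∷ models S p
    }

  module Extension (P : Env → Set) (x : Nom) (R : RoleName) (y : Nom) (α : Concept)
                   (x≢y : x ≢ y) where

    record Extends (ρ : Env) : Set where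
      constructor extends
      field
        origin   : Env
        in-P     : P origin
        agree    : AgreeOff y ρ origin
        linked   : role R (ρ x) (ρ y)
        labelled : ρ y ⊨ α
    open Extends

    extends-update : ∀ {ρ₀ v} → P ρ₀ → role R (ρ₀ x) v → v ⊨ α → Extends (ρ₀ [ y ↦ v ])
    extends-update {ρ₀} {v} p r a =
      extends ρ₀ p (update-other ρ₀ y v)
        (subst₂ (role R) (sym (update-other ρ₀ y v x x≢y)) (sym (update-same ρ₀ y v)) r)
        (subst (_⊨ α) (sym (update-same ρ₀ y v)) a)

    extends-step : ∀ {ρ ρ₁ v} (e : Extends ρ) → P ρ₁ → origin e ≤ₑ ρ₁
                 → role R (ρ₁ x) v → ρ y ≼ v
                 → Extends (ρ₁ [ y ↦ v ]) × ρ ≤ₑ (ρ₁ [ y ↦ v ])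
    extends-step {ρ₁ = ρ₁} e p₁ o≤ρ₁ r y≼v =
      extends-update p₁ r (persistent α y≼v (labelled e)) ,
      update-≤ (λ n n≢y → subst (_≼ ρ₁ n) (sym (agree e n n≢y)) (o≤ρ₁ n)) y≼v

    -- Moving y uses F2 to move x along; moving another nominal uses F1 to
    -- find a new successor for y.
    extension-mobile : Mobile P → Mobile Extends
    extension-mobile mob {ρ} n {z} e le with n ≟ y
    ... | yes refl =
      let (w' , r' , x≼w') = F2 R le (linked e)
          (ρ₁ , p₁ , o≤ρ₁ , ρ₁x) = mob x (in-P e) (subst (_≼ w') (agree e x x≢y) x≼w')
          (e' , ρ≤) = extends-step e p₁ o≤ρ₁ (subst (λ c → role R c z) (sym ρ₁x) r') le
      in ρ₁ [ y ↦ z ] , e' , ρ≤ , update-same ρ₁ y z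
    ... | no n≢y =
      let (ρ₁ , p₁ , o≤ρ₁ , ρ₁n) = mob n (in-P e) (subst (_≼ z) (agree e n n≢y) le)
          (v , r , y≼v) = F1 R (subst (_≼ ρ₁ x) (sym (agree e x x≢y)) (o≤ρ₁ x)) (linked e)
          (e' , ρ≤) = extends-step e p₁ o≤ρ₁ r y≼v
      in ρ₁ [ y ↦ v ] , e' , ρ≤ , trans (update-other ρ₁ y v n n≢y) ρ₁n

  extend : ∀ {w Δ ρ x R y α v} → x ≢ y → y ∉ concatMap noms Δ → Support w Δ ρ
         → role R (ρ x) v → v ⊨ α → Support w (rel x R y ∷ (y ∶ α) ∷ Δ) (ρ [ y ↦ v ])
  extend {Δ = Δ} {x = x} {R} {y} {α} x≢y fresh S r a = record
    { family = Extends
    ; member = extends-update (member S) r a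
    ; mobile = extension-mobile (mobile S)
    ; models = λ e → linked e ∷ labelled e ∷ holds-off-all Δ fresh (agree e) (models S (in-P e))
    }
    where open Extension (family S) x R y α x≢y
          open Extends

  struct-valid : ∀ {Δ Δ' δ} → Valid Δ δ → (∀ {φ} → φ ∈ Δ → φ ∈ Δ') → Valid Δ' δ
  struct-valid (valid premise) sub = valid λ S →
    premise (reshape S (λ hs → tabulate (lookup hs ∘ sub)))

  cut-valid : ∀ {Δ φ δ} → Valid Δ φ → Valid (φ ∷ Δ) δ → Valid Δ δ
  cut-valid (valid left) (valid right) = valid λ S →
    right (refine S (λ p → left (relocate S p) ∷ models S p))

  ∀-r-valid : ∀ {Δ x y R α} → FreshIn y Δ (x ∶ allR R α)
            → Valid (rel x R y ∷ Δ) (y ∶ α) → Valid Δ (x ∶ allR R α)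
  ∀-r-valid {x = x} {y} {R} {α} fr (valid premise) = valid λ S c x≼c v r →
    let (ρ' , p' , _ , ρ'x) = mobile S x (member S) x≼c
        S' = extend {α = top} (fr ∘ here ∘ sym) (fr ∘ there) (relocate S p')
                    (subst (λ d → role R d v) (sym ρ'x) r) tt
    in subst (_⊨ α) (update-same ρ' y v) (premise (reshape S' λ { (xRy ∷ _ ∷ hs) → xRy ∷ hs }))

  ∀-l-valid : ∀ {Δ x y R α δ} → Valid ((y ∶ α) ∷ (x ∶ allR R α) ∷ rel x R y ∷ Δ) δ
            → Valid ((x ∶ allR R α) ∷ rel x R y ∷ Δ) δ
  ∀-l-valid (valid premise) = valid λ S →
    premise (reshape S λ { (all ∷ r ∷ hs) → all _ (≼-refl _) _ r ∷ all ∷ r ∷ hs })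

  ∃-l-valid : ∀ {Δ x y R α δ} → FreshIn y ((x ∶ exR R α) ∷ Δ) δ
            → Valid (rel x R y ∷ (y ∶ α) ∷ Δ) δ → Valid ((x ∶ exR R α) ∷ Δ) δ
  ∃-l-valid {Δ} {x} {y} {δ = δ} fr (valid premise) = valid λ {ρ = ρ} S →
    let (v , r , a) = head (current S)
    in holds-off δ (fr ∘ ∈-++⁺ˡ) (λ n n≢y → sym (update-other ρ y v n n≢y))
         (premise (extend x≢y (fr ∘ ∈-++⁺ʳ (noms δ) ∘ there) (reshape S tail) r a))
    where
      x≢y : x ≢ y
      x≢y x≡y = fr (∈-++⁺ʳ (noms δ) (here (sym x≡y)))

  ⊑-r-valid : ∀ {Δ α β} → Valid (con α ∷ Δ) (con β) → Valid Δ (con (α ⊑ β))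
  ⊑-r-valid {Δ} (valid premise) = valid λ S w' w≼w' a →
    premise (reshape S (λ hs → a ∷ holds-world Δ w≼w' hs))

  ⊑-rN-valid : ∀ {Δ x α β} → Valid ((x ∶ α) ∷ Δ) (x ∶ β) → Valid Δ (x ∶ (α ⊑ β))
  ⊑-rN-valid {x = x} {α} {β} (valid premise) = valid λ S c x≼c a →
    let (ρ' , p' , _ , ρ'x) = mobile S x (member S) x≼c
    in subst (_⊨ β) ρ'x
         (premise (restrict (stable-nom (x ∶ᶜ α)) (relocate S p') (subst (_⊨ α) (sym ρ'x) a)))

  -- Left rules for ⊑, ⊓, ⊔, uniformly for concepts and nominal assertions:
  -- χ behaves as φ ⊑ ψ, φ ⊓ ψ or φ ⊔ ψ respectively.
  ⊑-left : ∀ {Δ₁ Δ₂ φ ψ χ δ} → (∀ {w ρ} → Holds w ρ χ → Holds w ρ φ → Holds w ρ ψ)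
         → Valid Δ₁ φ → Valid (ψ ∷ Δ₂) δ → Valid (χ ∷ Δ₁ ++ Δ₂) δ
  ⊑-left {Δ₁} mp (valid left) (valid right) = valid λ S → right (refine S λ p →
    mp (head (models S p)) (left (reshape (relocate S p) (++⁻ˡ Δ₁ ∘ tail)))
      ∷ ++⁻ʳ Δ₁ (tail (models S p)))

  ⊓-left : ∀ {Δ φ ψ χ δ} → (∀ {w ρ} → Holds w ρ χ → Holds w ρ φ × Holds w ρ ψ)
         → Valid (φ ∷ ψ ∷ Δ) δ → Valid (χ ∷ Δ) δ
  ⊓-left split (valid premise) = valid λ S →
    premise (reshape S λ { (h ∷ hs) → proj₁ (split h) ∷ proj₂ (split h) ∷ hs })

  ⊔-left : ∀ {Δ φ ψ χ δ} → Stable φ → Stable ψ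
         → (∀ {w ρ} → Holds w ρ χ → Holds w ρ φ ⊎ Holds w ρ ψ)
         → Valid (φ ∷ Δ) δ → Valid (ψ ∷ Δ) δ → Valid (χ ∷ Δ) δ
  ⊔-left stable-φ stable-ψ split (valid left) (valid right) = valid λ S →
    Sum.[ (λ h → left (restrict stable-φ (reshape S tail) h))
        , (λ h → right (restrict stable-ψ (reshape S tail) h)) ] (split (head (current S)))

  lower : ∀ {w w' z ρ R} Δ → w ≼ w' → role R w' z
        → All (Holds w ρ) (map (liftAll R) Δ) → All (Holds z ρ) Δ
  lower [] le r [] = []
  lower {w' = w'} {z} (con C ∷ Δ) le r (h ∷ hs) = h w' le z r ∷ lower Δ le r hs
  lower (nom N ∷ Δ) le r (h ∷ hs) = h ∷ lower Δ le r hs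
  lower (rel _ _ _ ∷ Δ) le r (h ∷ hs) = h ∷ lower Δ le r hs

  p-∃-valid : ∀ {Δ R α β} → Valid (con α ∷ Δ) (con β)
            → Valid (con (exR R α) ∷ map (liftAll R) Δ) (con (exR R β))
  p-∃-valid {Δ} (valid premise) = valid λ S →
    let (v , r , a) = head (current S)
    in v , r , premise (reshape S λ { (_ ∷ hs) → a ∷ lower Δ (≼-refl _) r hs })

  p-∀-valid : ∀ {Δ R α} → Valid Δ (con α) → Valid (map (liftAll R) Δ) (con (allR R α))
  p-∀-valid {Δ} (valid premise) = valid λ S w' w≼w' z r →
    premise (reshape S (lower Δ w≼w' r))

  -- Moving into x: prefixed concepts are read at σ x (using the base
  -- environment σ), assertions at any environment ρ of the family.
  enter : ∀ {w σ ρ} x Γ → All (Holds w σ) (map (prefix x) Γ) → All (Holds w ρ) (map (prefix x) Γ)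
        → All (Holds (σ x) ρ) Γ
  enter x [] _ _ = []
  enter x (con C ∷ Γ) (h ∷ base) (_ ∷ hs) = h ∷ enter x Γ base hs
  enter x (nom N ∷ Γ) (_ ∷ base) (h ∷ hs) = h ∷ enter x Γ base hs
  enter x (rel _ _ _ ∷ Γ) (_ ∷ base) (h ∷ hs) = h ∷ enter x Γ base hs

  leave : ∀ {w σ} x δ → Holds (σ x) σ δ → Holds w σ (prefix x δ)
  leave x (con C) h = h
  leave x (nom N) h = h
  leave x (rel _ _ _) h = h

  p-N-valid : ∀ {Δ x δ} → Valid Δ δ → Valid (map (prefix x) Δ) (prefix x δ)
  p-N-valid {Δ} {x} {δ} (valid premise) = valid λ S →
    leave x δ (premise (reshape S (enter x Δ (current S))))

  soundness : ∀ {Δ δ} → Δ ⊢ δ → Valid Δ δ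
  soundness (struct d sub) = struct-valid (soundness d) sub
  soundness (cut d e) = cut-valid (soundness d) (soundness e)
  soundness (ax m) = valid λ S → lookup (current S) m
  soundness (ax⊥ m) = valid λ S → ⊥-elim (lookup (current S) m)
  soundness (∀-r d fr) = ∀-r-valid fr (soundness d)
  soundness (∀-l d) = ∀-l-valid (soundness d)
  soundness (∃-r d e) = valid λ S →
    _ , holds-under (soundness d) S , holds-under (soundness e) S
  soundness (∃-l d fr) = ∃-l-valid fr (soundness d)
  soundness (⊑-r d) = ⊑-r-valid (soundness d)
  soundness (⊑-l d e) = ⊑-left (λ f a → f _ (≼-refl _) a) (soundness d) (soundness e)
  soundness (⊓-r d e) = valid λ S → holds-under (soundness d) S , holds-under (soundness e) S
  soundness (⊓-l d) = ⊓-left (λ h → h) (soundness d)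
  soundness (⊔₁-r d) = valid (inj₁ ∘ holds-under (soundness d))
  soundness (⊔₂-r d) = valid (inj₂ ∘ holds-under (soundness d))
  soundness (⊔-l {α = α} {β} d e) =
    ⊔-left (stable-con α) (stable-con β) (λ h → h) (soundness d) (soundness e)
  soundness (⊑-rN d) = ⊑-rN-valid (soundness d)
  soundness (⊑-lN d e) = ⊑-left (λ f a → f _ (≼-refl _) a) (soundness d) (soundness e)
  soundness (⊓-rN d e) = valid λ S → holds-under (soundness d) S , holds-under (soundness e) S
  soundness (⊓-lN d) = ⊓-left (λ h → h) (soundness d)
  soundness (⊔₁-rN d) = valid (inj₁ ∘ holds-under (soundness d))
  soundness (⊔₂-rN d) = valid (inj₂ ∘ holds-under (soundness d))
  soundness (⊔-lN {x = x} {α} {β} d e) =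
    ⊔-left (stable-nom (x ∶ᶜ α)) (stable-nom (x ∶ᶜ β)) (λ h → h) (soundness d) (soundness e)
  soundness (p-∃ d) = p-∃-valid (soundness d)
  soundness (p-∀ d) = p-∀-valid (soundness d)
  soundness (p-N d) = p-N-valid (soundness d)

  above-mobile : ∀ ρ₀ → Mobile (ρ₀ ≤ₑ_)
  above-mobile ρ₀ {ρ} n {z} ρ₀≤ρ ρn≼z =
    ρ [ n ↦ z ] ,
    update-≤ (λ m _ → ρ₀≤ρ m) (≼-trans (ρ₀≤ρ n) ρn≼z) ,
    update-≤ (λ m _ → ≼-refl (ρ m)) ρn≼z ,
    update-same ρ n z

  satN→holdsN : ∀ {w ρ} N → nomv ≤ₑ ρ → satN I w N → holdsN ρ N
  satN→holdsN {ρ = ρ} (x ∶ᶜ C) ν≤ρ h = h (ρ x) (ν≤ρ x)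
  satN→holdsN {ρ = ρ} (x ∶ⁿ N) ν≤ρ h = satN→holdsN {w = ρ x} N ν≤ρ (h (ρ x) (ν≤ρ x))

  sat→holds : ∀ {w ρ} Δ → nomv ≤ₑ ρ → All (sat I w) Δ → All (Holds w ρ) Δ
  sat→holds [] ν≤ρ [] = []
  sat→holds (con C ∷ Δ) ν≤ρ (h ∷ hs) = h ∷ sat→holds Δ ν≤ρ hs
  sat→holds {w} (nom N ∷ Δ) ν≤ρ (h ∷ hs) =
    satN→holdsN {w = w} N ν≤ρ h ∷ sat→holds Δ ν≤ρ hs
  sat→holds {ρ = ρ} (rel x R y ∷ Δ) ν≤ρ (h ∷ hs) =
    h (ρ x) (ρ y) (ν≤ρ x) (ν≤ρ y) ∷ sat→holds Δ ν≤ρ hs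

  holdsN→satN : ∀ {w} N → holdsN nomv N → satN I w N
  holdsN→satN (x ∶ᶜ C) h = λ z le → persistent C le h
  holdsN→satN (x ∶ⁿ N) h = λ z _ → holdsN→satN {w = z} N h

  initial : ∀ {w Δ} → All (sat I w) Δ → Support w Δ nomv
  initial {Δ = Δ} hs = record
    { family = nomv ≤ₑ_
    ; member = λ n → ≼-refl (nomv n)
    ; mobile = above-mobile nomv
    ; models = λ ν≤ρ → sat→holds Δ ν≤ρ hs
    }

  local-soundness : ∀ {w Δ δ} → Δ ⊢ δ → All (sat I w) Δ → sat I w δ
  local-soundness {δ = con C} d hs = holds-under (soundness d) (initial hs)
  local-soundness {w} {δ = nom N} d hs =
    holdsN→satN {w = w} N (holds-under (soundness d) (initial hs))
  local-soundness {δ = rel a R b} d hs with RoleInversion.invert a R b d refl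
  ... | inj₁ m = lookup hs m
  ... | inj₂ (_ , d') = ⊥-elim (holds-under (soundness d') (initial hs))

mainTheorem2 : (Θ Γ : List Form) (δ : Form)
    → All IsFormula Θ
    → (Θ ++ Γ) ⊢ δ
    → Consequence Θ Γ δ
mainTheorem2 Θ Γ δ _ d I hΘ w hΓ = Semantics.local-soundness I d (++⁺ (hΘ w) hΓ)
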